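{- The map sending a sequence $C=(c_n)_{n\ge1}$ of positive integers to the sequence $F=(F_n)_{n\ge1}$ given by $F_n=\prod_{d\mid n}c_d$ (i.e. $F=\prod_{n\ge1}G_{c_n,n}$, pointwise) is a bijection from the set of positive-integer sequences $C$ satisfying $$\text{(C1)}\qquad \text{for all } k,n\ge1:\quad k<n \ \text{ and } \ \gcd(n,k)\neq k \ \Longrightarrow\ \gcd(c_n,c_k)=1$$ onto the set of all GCD-morphic sequences of positive integers. In particular, every such $C$ encodes a GCD-morphic sequence, and every GCD-morphic sequence of positive integers is encoded by exactly one such $C$.
   Context: A sequence $(F_k)_{k\ge1}$ of positive integers is called GCD-morphic if $\gcd(F_k,F_l)=F_{\gcd(k,l)}$ for all $k,l\ge1$. For positive integers $c,N$, the primary GCD-morphic sequence $G_{c,N}=(g_k)_{k\ge1}$ is given by $g_k=c$ if $N\mid k$ and $g_k=1$ otherwise. Products of sequences are taken pointwise. -}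

module Defs where

open import Data.Nat using (ℕ; suc; _<_; _≤_)
open import Data.Nat.Divisibility using (_∣_; _∣?_)
open import Data.Nat.GCD using (gcd)
open import Data.List using (List; applyUpTo; filter; map)
open import Data.Nat.ListAction using (product)
open import Data.Product using (_×_)
open import Relation.Binary.PropositionalEquality using (_≡_; _≢_)

-- A sequence (x_n)_{n≥1} is represented as a function ℕ → ℕ; only the
-- values at positive indices are relevant (the value at 0 is ignored).
Seq : Set
Seq = ℕ → ℕ

Positive : Seq → Set
Positive x = ∀ n → 1 ≤ n → 1 ≤ x n

GCDMorphic : Seq → Set
GCDMorphic F = ∀ k l → 1 ≤ k → 1 ≤ l → gcd (F k) (F l) ≡ F (gcd k l)

divisors : ℕ → List ℕ
divisors n = filter (_∣? n) (applyUpTo suc n)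

encode : Seq → Seq
encode c n = product (map c (divisors n))

C1 : Seq → Set
C1 c = ∀ k n → 1 ≤ k → 1 ≤ n → k < n → gcd n k ≢ k → gcd (c n) (c k) ≡ 1

Admissible : Seq → Set
Admissible c = Positive c × C1 c

_≋_ : Seq → Seq → Set
x ≋ y = ∀ n → 1 ≤ n → x n ≡ y n

module Submission where

-- We work with the encoding as the finite product  F_n = ∏_{d=1}^{n} [d ∣ n] c_d,
-- and split off its top factor:  F_n = c_n · P_n,  where the "proper part"
-- P_n = ∏_{d<n, d∣n} c_d only involves earlier terms of C.  For g ∣ N the
-- product for N splits as  F_N = F_g · ∏_{e∣N, e∤g} c_e.
--
-- * Well-definedness: with g = gcd k l,  F_k = F_g · X  and  F_l = F_g · Y,
--   and (C1) makes X and Y coprime, hence  gcd (F_k, F_l) = F_g.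
-- * Injectivity: by strong induction, c_n = F_n / P_n is determined by F.
-- * Surjectivity: define c by course-of-values recursion, c_n = F_n / P_n.
--   Inductively c encodes F: P_N ∣ F_N is shown by multiplying in the proper
--   divisors of N one at a time, using that (C1) holds among earlier terms,
--   which in turn follows from the agreement with F obtained so far.

open import Defs
open import Data.Product using (_×_; Σ-syntax; _,_; proj₁; proj₂)
open import Data.Nat
open import Data.Nat.Properties
open import Data.Nat.Divisibility
open import Data.Nat.DivMod using (_/_; m*[n/m]≡n)
open import Data.Nat.GCD
open import Data.Nat.LCM using (lcm; lcm-least; gcd*lcm)
open import Data.Nat.Coprimality using (coprime-divisor; gcd≡1⇒coprime; coprime⇒gcd≡1)
open import Data.Nat.Induction using (<-wellFounded; <-rec)
open import Data.Nat.ListAction using (product)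
open import Data.Nat.ListAction.Properties using (product-++)
open import Data.List using ([]; _∷_; [_]; _++_; applyUpTo; filter; map)
open import Data.List.Properties using (applyUpTo-∷ʳ; map-++)
open import Data.Sum using (inj₁; inj₂)
open import Data.Bool using (if_then_else_)
open import Function using (_∘′_)
open import Relation.Nullary using (Dec; yes; no; does; ¬_; contradiction; ¬?; _×-dec_)
open import Relation.Binary using (tri<; tri≈; tri>)
open import Relation.Binary.PropositionalEquality using (_≡_; refl; sym; trans; cong; cong₂; subst; module ≡-Reasoning)
open import Induction.WellFounded using (module FixPoint)
open import Algebra.Properties.CommutativeSemigroup *-commutativeSemigroup using (interchange)

open ≡-Reasoning

positive-factors : ∀ a b → 1 ≤ a * b → 1 ≤ a × 1 ≤ b
positive-factors a b p =
  >-nonZero⁻¹ a {{m*n≢0⇒m≢0 a {{>-nonZero p}}}} , >-nonZero⁻¹ b {{m*n≢0⇒n≢0 a {{>-nonZero p}}}}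

gcd-pos : ∀ k l → 1 ≤ k → 1 ≤ gcd k l
gcd-pos k l 1≤k = n≢0⇒n>0 (gcd[m,n]≢0 k l (inj₁ (m<n⇒n≢0 1≤k)))

gcd-of-divisor : ∀ {k n} → k ∣ n → gcd n k ≡ k
gcd-of-divisor {k} {n} k∣n = ∣-antisym (gcd[m,n]∣n n k) (gcd-greatest k∣n ∣-refl)

coprime-*ʳ : ∀ x a b → gcd x a ≡ 1 → gcd x b ≡ 1 → gcd x (a * b) ≡ 1
coprime-*ʳ x a b xa xb = coprime⇒gcd≡1 λ {i} (i∣x , i∣ab) →
  gcd≡1⇒coprime {x} {b} xb (i∣x , coprime-divisor {i} {a} {b}
    (λ {j} (j∣i , j∣a) → gcd≡1⇒coprime {x} {a} xa (∣-trans j∣i i∣x , j∣a)) i∣ab)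

coprime-*-∣ : ∀ {a b y} → gcd a b ≡ 1 → a ∣ y → b ∣ y → a * b ∣ y
coprime-*-∣ {a} {b} cop a∣y b∣y = subst (_∣ _) a*b≡lcm (lcm-least a∣y b∣y)
  where
  a*b≡lcm : lcm a b ≡ a * b
  a*b≡lcm = begin
    lcm a b           ≡⟨ sym (*-identityˡ _) ⟩
    1 * lcm a b       ≡⟨ cong (_* lcm a b) (sym cop) ⟩
    gcd a b * lcm a b ≡⟨ gcd*lcm a b ⟩
    a * b             ∎

-- division by a divisor known to be positive; total, and exact when b ∣ a
_÷_ : ℕ → ℕ → ℕ
a ÷ b = a / suc (pred b)

÷-exact : ∀ {a b} → 1 ≤ b → b ∣ a → b * (a ÷ b) ≡ a
÷-exact {a} {b} 1≤b b∣a =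
  subst (λ q → q * (a ÷ b) ≡ a) b′≡b (m*[n/m]≡n (subst (_∣ a) (sym b′≡b) b∣a))
  where
  b′≡b : suc (pred b) ≡ b
  b′≡b = suc-pred b {{>-nonZero 1≤b}}

combine : ∀ {a A B x} → 1 ≤ A → gcd a B ≡ 1 → a * A ∣ x → A * B ∣ x → a * (A * B) ∣ x
combine {a} {A} {B} 1≤A cop aA∣x AB∣x with m*n∣⇒m∣ A B AB∣x
... | divides y refl = subst (_∣ y * A) rearrange (*-monoˡ-∣ A (coprime-*-∣ cop a∣y B∣y))
  where
  instance _ = >-nonZero 1≤A
  a∣y : a ∣ y
  a∣y = *-cancelʳ-∣ A aA∣x
  B∣y : B ∣ y
  B∣y = *-cancelʳ-∣ A (subst (_∣ y * A) (*-comm A B) AB∣x)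
  rearrange : a * B * A ≡ a * (A * B)
  rearrange = trans (*-assoc a B A) (cong (a *_) (*-comm B A))

Π : ℕ → (ℕ → ℕ) → ℕ
Π zero f = 1
Π (suc m) f = f (suc m) * Π m f

Π-cong : ∀ m {f g} → (∀ d → 1 ≤ d → d ≤ m → f d ≡ g d) → Π m f ≡ Π m g
Π-cong zero h = refl
Π-cong (suc m) h = cong₂ _*_ (h (suc m) z<s ≤-refl) (Π-cong m λ d p q → h d p (m≤n⇒m≤1+n q))

Π-pos : ∀ m {f} → (∀ d → 1 ≤ d → d ≤ m → 1 ≤ f d) → 1 ≤ Π m f
Π-pos zero h = ≤-refl
Π-pos (suc m) h = *-mono-≤ (h (suc m) z<s ≤-refl) (Π-pos m λ d p q → h d p (m≤n⇒m≤1+n q))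

Π-* : ∀ m f g → Π m (λ d → f d * g d) ≡ Π m f * Π m g
Π-* zero f g = refl
Π-* (suc m) f g = begin
  f (suc m) * g (suc m) * Π m (λ d → f d * g d) ≡⟨ cong (f (suc m) * g (suc m) *_) (Π-* m f g) ⟩
  f (suc m) * g (suc m) * (Π m f * Π m g)       ≡⟨ interchange (f (suc m)) (g (suc m)) (Π m f) (Π m g) ⟩
  f (suc m) * Π m f * (g (suc m) * Π m g)       ∎

Π-extend : ∀ {m} M f → m ≤ M → (∀ d → m < d → d ≤ M → f d ≡ 1) → Π M f ≡ Π m f
Π-extend M f m≤M h with m≤n⇒m<n∨m≡n m≤M
... | inj₂ refl = refl
Π-extend {m} (suc M) f _ h | inj₁ (s≤s m≤M) = begin
  f (suc M) * Π M f ≡⟨ cong₂ _*_ (h (suc M) (s≤s m≤M) ≤-refl)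
                               (Π-extend M f m≤M λ d p q → h d p (m≤n⇒m≤1+n q)) ⟩
  1 * Π m f         ≡⟨ *-identityˡ (Π m f) ⟩
  Π m f             ∎

Π-coprimeʳ : ∀ m x f → (∀ d → 1 ≤ d → d ≤ m → gcd x (f d) ≡ 1) → gcd x (Π m f) ≡ 1
Π-coprimeʳ zero x f h = gcd-zeroʳ x
Π-coprimeʳ (suc m) x f h = coprime-*ʳ x (f (suc m)) (Π m f) (h (suc m) z<s ≤-refl)
  (Π-coprimeʳ m x f λ d p q → h d p (m≤n⇒m≤1+n q))

Π-coprime : ∀ m f g → (∀ d e → 1 ≤ d → d ≤ m → 1 ≤ e → e ≤ m → gcd (f d) (g e) ≡ 1) →
            gcd (Π m f) (Π m g) ≡ 1
Π-coprime m f g h = Π-coprimeʳ m (Π m f) g λ e p q →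
  trans (gcd-comm (Π m f) (g e)) (Π-coprimeʳ m (g e) f λ d p′ q′ →
    trans (gcd-comm (g e) (f d)) (h d e p′ q′ p q))

when : {P : Set} → Dec P → ℕ → ℕ
when D x = if does D then x else 1

when-yes : ∀ {P : Set} (D : Dec P) {x} → P → when D x ≡ x
when-yes (yes _) _ = refl
when-yes (no ¬p) p = contradiction p ¬p

when-no : ∀ {P : Set} (D : Dec P) {x} → ¬ P → when D x ≡ 1
when-no (yes p) ¬p = contradiction p ¬p
when-no (no _) _ = refl

when-pos : ∀ {P : Set} (D : Dec P) {x} → 1 ≤ x → 1 ≤ when D x
when-pos (yes _) p = p
when-pos (no _) _ = ≤-refl

when-coprimeˡ : ∀ {P : Set} (D : Dec P) x y → (P → gcd x y ≡ 1) → gcd (when D x) y ≡ 1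
when-coprimeˡ (yes p) x y h = h p
when-coprimeˡ (no _) x y _ = gcd-zeroˡ y

factor : Seq → ℕ → ℕ → ℕ
factor c n d = when (d ∣? n) (c d)

excess : Seq → ℕ → ℕ → ℕ → ℕ
excess c n g e = when (e ∣? n ×-dec ¬? (e ∣? g)) (c e)

encode′ : Seq → ℕ → ℕ
encode′ c n = Π n (factor c n)

properPart : Seq → ℕ → ℕ
properPart c n = Π (pred n) (factor c n)

product-filter : ∀ c n xs → product (map c (filter (_∣? n) xs)) ≡ product (map (factor c n) xs)
product-filter c n [] = refl
product-filter c n (x ∷ xs) with x ∣? n
... | yes _ = cong (c x *_) (product-filter c n xs)
... | no _ = trans (product-filter c n xs) (sym (*-identityˡ _))

product-upTo : ∀ m f → product (map f (applyUpTo suc m)) ≡ Π m f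
product-upTo zero f = refl
product-upTo (suc m) f = begin
  product (map f (applyUpTo suc (suc m)))
    ≡⟨ cong (product ∘′ map f) (sym (applyUpTo-∷ʳ suc m)) ⟩
  product (map f (applyUpTo suc m ++ [ suc m ]))
    ≡⟨ cong product (map-++ f (applyUpTo suc m) [ suc m ]) ⟩
  product (map f (applyUpTo suc m) ++ [ f (suc m) ])
    ≡⟨ product-++ (map f (applyUpTo suc m)) [ f (suc m) ] ⟩
  product (map f (applyUpTo suc m)) * (f (suc m) * 1)
    ≡⟨ cong₂ _*_ (product-upTo m f) (*-identityʳ (f (suc m))) ⟩
  Π m f * f (suc m)
    ≡⟨ *-comm (Π m f) (f (suc m)) ⟩
  Π (suc m) f ∎

encode≡encode′ : ∀ c n → encode c n ≡ encode′ c n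
encode≡encode′ c n = trans (product-filter c n (applyUpTo suc n)) (product-upTo n (factor c n))

encode′-split : ∀ c n → 1 ≤ n → encode′ c n ≡ c n * properPart c n
encode′-split c (suc m) _ = cong (_* properPart c (suc m)) (when-yes (suc m ∣? suc m) ∣-refl)

encode′-extend : ∀ c {n} M → 1 ≤ n → n ≤ M → Π M (factor c n) ≡ encode′ c n
encode′-extend c {n} M 1≤n n≤M = Π-extend M (factor c n) n≤M λ d n<d _ →
  when-no (d ∣? n) λ d∣n → <⇒≱ n<d (∣⇒≤ {{>-nonZero 1≤n}} d∣n)

encode′-pos : ∀ c → Positive c → ∀ n → 1 ≤ encode′ c n
encode′-pos c c-pos n = Π-pos n λ d p _ → when-pos (d ∣? n) (c-pos d p)

properPart-pos : ∀ c n → (∀ d → 1 ≤ d → d < n → 1 ≤ c d) → 1 ≤ properPart c n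
properPart-pos c zero _ = ≤-refl
properPart-pos c (suc m) h = Π-pos m λ d p q → when-pos (d ∣? suc m) (h d p (s≤s q))

properPart-cong : ∀ c c′ n → (∀ d → 1 ≤ d → d < n → c d ≡ c′ d) → properPart c n ≡ properPart c′ n
properPart-cong c c′ zero _ = refl
properPart-cong c c′ (suc m) h = Π-cong m λ d p q → cong (when (d ∣? suc m)) (h d p (s≤s q))

factor-split : ∀ c {N g} e → g ∣ N → factor c N e ≡ factor c g e * excess c N g e
factor-split c {N} {g} e g∣N with e ∣? N | e ∣? g
... | yes _ | yes _ = sym (*-identityʳ _)
... | yes _ | no _ = sym (*-identityˡ _)
... | no e∤N | yes e∣g = contradiction (∣-trans e∣g g∣N) e∤N
... | no _ | no _ = refl

Π-factor-split : ∀ c M {N g} → g ∣ N → Π M (factor c N) ≡ Π M (factor c g) * Π M (excess c N g)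
Π-factor-split c M {N} {g} g∣N =
  trans (Π-cong M λ e _ _ → factor-split c e g∣N) (Π-* M (factor c g) (excess c N g))

encode′-∣-properPart : ∀ c {g k} → 1 ≤ g → g < k → g ∣ k → encode′ c g ∣ properPart c k
encode′-∣-properPart c {g} {suc k} 1≤g (s≤s g≤k) g∣k =
  subst (_∣ properPart c (suc k)) (encode′-extend c k 1≤g g≤k)
    (subst (Π k (factor c g) ∣_) (sym (Π-factor-split c k g∣k)) (m∣m*n _))

C1-coprime : ∀ {c} → C1 c → ∀ {d e} → 1 ≤ d → 1 ≤ e → ¬ d ∣ e → ¬ e ∣ d → gcd (c d) (c e) ≡ 1
C1-coprime {c} C1c {d} {e} 1≤d 1≤e d∤e e∤d with <-cmp d e
... | tri< d<e _ _ =
  trans (gcd-comm (c d) (c e)) (C1c d e 1≤d 1≤e d<e λ eq → d∤e (subst (_∣ e) eq (gcd[m,n]∣m e d)))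
... | tri≈ _ refl _ = contradiction ∣-refl d∤e
... | tri> _ _ e<d = C1c e d 1≤e 1≤d e<d λ eq → e∤d (subst (_∣ d) eq (gcd[m,n]∣m d e))

coprime⇒C1 : ∀ {c} → (∀ k n → 1 ≤ k → k < n → ¬ k ∣ n → gcd (c n) (c k) ≡ 1) → C1 c
coprime⇒C1 h k n 1≤k _ k<n gcd≢k = h k n 1≤k k<n λ k∣n → gcd≢k (gcd-of-divisor k∣n)

excess-coprime : ∀ {c} → C1 c → ∀ k l {d e} → 1 ≤ d → 1 ≤ e →
                 gcd (excess c k (gcd k l) d) (excess c l (gcd k l) e) ≡ 1
excess-coprime {c} C1c k l {d} {e} 1≤d 1≤e =
  when-coprimeˡ (d ∣? k ×-dec ¬? (d ∣? g)) (c d) Y λ (d∣k , d∤g) →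
  trans (gcd-comm (c d) Y) (when-coprimeˡ (e ∣? l ×-dec ¬? (e ∣? g)) (c e) (c d) λ (e∣l , e∤g) →
  trans (gcd-comm (c e) (c d)) (C1-coprime {c = c} C1c 1≤d 1≤e
    (λ d∣e → d∤g (gcd-greatest d∣k (∣-trans d∣e e∣l)))
    (λ e∣d → e∤g (gcd-greatest (∣-trans e∣d d∣k) e∣l))))
  where
  g = gcd k l
  Y = excess c l g e

-- Well-definedness: over the common range 1 … k + l, F_k and F_l share the
-- factor A = F_g (g = gcd k l), and their remaining factors are coprime.
encode′-morphic : ∀ c → C1 c → ∀ k l → 1 ≤ k → 1 ≤ l →
                  gcd (encode′ c k) (encode′ c l) ≡ encode′ c (gcd k l)
encode′-morphic c C1c k l 1≤k 1≤l = begin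
  gcd (encode′ c k) (encode′ c l)
    ≡⟨ cong₂ gcd (sym (encode′-extend c M 1≤k (m≤m+n k l)))
                 (sym (encode′-extend c M 1≤l (m≤n+m l k))) ⟩
  gcd (Π M (factor c k)) (Π M (factor c l))
    ≡⟨ cong₂ gcd (Π-factor-split c M (gcd[m,n]∣m k l)) (Π-factor-split c M (gcd[m,n]∣n k l)) ⟩
  gcd (A * Π M (excess c k g)) (A * Π M (excess c l g))
    ≡⟨ sym (c*gcd[m,n]≡gcd[cm,cn] A _ _) ⟩
  A * gcd (Π M (excess c k g)) (Π M (excess c l g))
    ≡⟨ cong (A *_) (Π-coprime M (excess c k g) (excess c l g) λ d e p _ p′ _ →
                      excess-coprime C1c k l p p′) ⟩
  A * 1
    ≡⟨ *-identityʳ A ⟩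
  A
    ≡⟨ encode′-extend c M (gcd-pos k l 1≤k)
         (≤-trans (∣⇒≤ {{>-nonZero 1≤k}} (gcd[m,n]∣m k l)) (m≤m+n k l)) ⟩
  encode′ c g ∎
  where
  M = k + l
  g = gcd k l
  A = Π M (factor c g)

well-defined : ∀ c → Admissible c → Positive (encode c) × GCDMorphic (encode c)
well-defined c (c-pos , C1c) =
  (λ n _ → subst (1 ≤_) (sym (encode≡encode′ c n)) (encode′-pos c c-pos n)) ,
  λ k l 1≤k 1≤l → begin
    gcd (encode c k) (encode c l)   ≡⟨ cong₂ gcd (encode≡encode′ c k) (encode≡encode′ c l) ⟩
    gcd (encode′ c k) (encode′ c l) ≡⟨ encode′-morphic c C1c k l 1≤k 1≤l ⟩
    encode′ c (gcd k l)             ≡⟨ sym (encode≡encode′ c (gcd k l)) ⟩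
    encode c (gcd k l)              ∎

injective : ∀ c c′ → Admissible c → Admissible c′ → encode c ≋ encode c′ → c ≋ c′
injective c c′ (c-pos , _) _ same = <-rec (λ n → 1 ≤ n → c n ≡ c′ n) agree
  where
  agree : ∀ n → (∀ {d} → d < n → 1 ≤ d → c d ≡ c′ d) → 1 ≤ n → c n ≡ c′ n
  agree n earlier 1≤n = *-cancelʳ-≡ (c n) (c′ n) (properPart c n) {{>-nonZero P-pos}} (begin
    c n * properPart c n   ≡⟨ sym (encode′-split c n 1≤n) ⟩
    encode′ c n            ≡⟨ sym (encode≡encode′ c n) ⟩
    encode c n             ≡⟨ same n 1≤n ⟩
    encode c′ n            ≡⟨ encode≡encode′ c′ n ⟩
    encode′ c′ n           ≡⟨ encode′-split c′ n 1≤n ⟩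
    c′ n * properPart c′ n ≡⟨ cong (c′ n *_) (properPart-cong c′ c n λ d p q → sym (earlier q p)) ⟩
    c′ n * properPart c n  ∎)
    where
    P-pos : 1 ≤ properPart c n
    P-pos = properPart-pos c n λ d p _ → c-pos d p

EncodesUpTo : Seq → Seq → ℕ → Set
EncodesUpTo c F m = ∀ n → 1 ≤ n → n ≤ m → encode′ c n ≡ F n

agreement⇒pos : ∀ {c F m} → Positive F → EncodesUpTo c F m →
                ∀ {n} → 1 ≤ n → n ≤ m → 1 ≤ c n × 1 ≤ properPart c n
agreement⇒pos {c} {F} F-pos agree {n} 1≤n n≤m = positive-factors (c n) (properPart c n)
  (subst (1 ≤_) (trans (sym (agree n 1≤n n≤m)) (encode′-split c n 1≤n)) (F-pos n 1≤n))

morphic-∣ : ∀ {F} → GCDMorphic F → ∀ {d N} → 1 ≤ d → 1 ≤ N → d ∣ N → F d ∣ F N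
morphic-∣ {F} F-morphic {d} {N} 1≤d 1≤N d∣N =
  subst (_∣ F N) (trans (F-morphic d N 1≤d 1≤N) (cong F (trans (gcd-comm d N) (gcd-of-divisor d∣N))))
    (gcd[m,n]∣n (F d) (F N))

-- Agreement with a GCD-morphic F up to n forces (C1) between n and smaller
-- indices: gcd(c_n, c_k) · F_g divides both F_n and F_k, with g = gcd n k a
-- proper divisor of both, hence divides gcd(F_n, F_k) = F_g.
agreement⇒coprime : ∀ {c F} → Positive F → GCDMorphic F → ∀ {n} → EncodesUpTo c F n →
                    ∀ {k} → 1 ≤ k → k < n → ¬ k ∣ n → gcd (c n) (c k) ≡ 1
agreement⇒coprime {c} {F} F-pos F-morphic {n} agree {k} 1≤k k<n k∤n =
  ∣1⇒≡1 (*-cancelʳ-∣ (encode′ c g) {{>-nonZero Fg-pos}} t·Fg∣Fg)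
  where
  1≤n = ≤-trans 1≤k (<⇒≤ k<n)
  g = gcd n k
  1≤g = gcd-pos n k 1≤n
  g<k : g < k
  g<k = ≤∧≢⇒< (∣⇒≤ {{>-nonZero 1≤k}} (gcd[m,n]∣n n k))
          λ g≡k → k∤n (subst (_∣ n) g≡k (gcd[m,n]∣m n k))
  Fg≡ : encode′ c g ≡ F g
  Fg≡ = agree g 1≤g (≤-trans (<⇒≤ g<k) (<⇒≤ k<n))
  Fg-pos : 1 ≤ encode′ c g
  Fg-pos = subst (1 ≤_) (sym Fg≡) (F-pos g 1≤g)
  t = gcd (c n) (c k)
  divides-F : ∀ {m} → 1 ≤ m → m ≤ n → t ∣ c m → g < m → g ∣ m → t * encode′ c g ∣ F m
  divides-F {m} 1≤m m≤n t∣cm g<m g∣m =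
    subst (t * encode′ c g ∣_) (trans (sym (encode′-split c m 1≤m)) (agree m 1≤m m≤n))
      (*-pres-∣ t∣cm (encode′-∣-properPart c 1≤g g<m g∣m))
  t·Fg∣Fg : t * encode′ c g ∣ 1 * encode′ c g
  t·Fg∣Fg = subst (t * encode′ c g ∣_)
    (trans (F-morphic n k 1≤n 1≤k) (trans (sym Fg≡) (sym (*-identityˡ _))))
    (gcd-greatest (divides-F 1≤n ≤-refl (gcd[m,n]∣m (c n) (c k)) (<-trans g<k k<n) (gcd[m,n]∣m n k))
                  (divides-F 1≤k (<⇒≤ k<n) (gcd[m,n]∣n (c n) (c k)) g<k (gcd[m,n]∣n n k)))

-- The prefix products over
-- 1 … r are built up one index d = r+1 at a time: for d ∣ N the new factor
-- c_d is coprime to the excess of N over d, and c_d · P_d = F_d ∣ F_N.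
properPart-∣ : ∀ {c F} → Positive F → GCDMorphic F → ∀ m → EncodesUpTo c F m →
               properPart c (suc m) ∣ F (suc m)
properPart-∣ {c} {F} F-pos F-morphic m agree = prefix m ≤-refl
  where
  N = suc m
  prefix : ∀ r → r ≤ m → Π r (factor c N) ∣ F N
  prefix zero _ = 1∣ _
  prefix (suc r) d≤m with suc r ∣? N
  ... | no d∤N = subst (_∣ F N) (sym skip) (prefix r (<⇒≤ d≤m))
    where
    skip : factor c N (suc r) * Π r (factor c N) ≡ Π r (factor c N)
    skip = trans (cong (_* Π r (factor c N)) (when-no (suc r ∣? N) d∤N)) (*-identityˡ _)
  ... | yes d∣N = subst (_∣ F N) (sym (cong₂ _*_ (when-yes (d ∣? N) d∣N) split))
        (combine {a = c d} P-pos coprime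
          (subst (_∣ F N) (sym cd·Pd≡Fd) (morphic-∣ {F = F} F-morphic z<s z<s d∣N))
          (subst (_∣ F N) split (prefix r (<⇒≤ d≤m))))
    where
    d = suc r
    split : Π r (factor c N) ≡ properPart c d * Π r (excess c N d)
    split = Π-factor-split c r d∣N
    cd·Pd≡Fd : c d * properPart c d ≡ F d
    cd·Pd≡Fd = trans (sym (encode′-split c d z<s)) (agree d z<s d≤m)
    P-pos : 1 ≤ properPart c d
    P-pos = proj₂ (agreement⇒pos F-pos agree z<s d≤m)
    coprime : gcd (c d) (Π r (excess c N d)) ≡ 1
    coprime = Π-coprimeʳ r (c d) (excess c N d) λ e 1≤e e≤r →
      trans (gcd-comm (c d) (excess c N d e))
        (when-coprimeˡ (e ∣? N ×-dec ¬? (e ∣? d)) (c e) (c d) λ (_ , e∤d) →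
         trans (gcd-comm (c e) (c d)) (agreement⇒coprime {c = c} F-pos F-morphic
           (λ n p q → agree n p (≤-trans q d≤m)) 1≤e (s≤s e≤r) e∤d))

module Surjectivity (F : Seq) (F-pos : Positive F) (F-morphic : GCDMorphic F) where

  fromEarlier : ∀ {n} → (∀ {d} → d < n → ℕ) → Seq
  fromEarlier {n} earlier d with d <? n
  ... | yes d<n = earlier d<n
  ... | no _ = 0

  next : ∀ n → (∀ {d} → d < n → ℕ) → ℕ
  next n earlier = F n ÷ properPart (fromEarlier earlier) n

  -- `next` only looks at the earlier terms, so the recursion unfolds
  next-cong : ∀ n {h h′ : ∀ {d} → d < n → ℕ} → (∀ {d} (d<n : d < n) → h d<n ≡ h′ d<n) →
              next n h ≡ next n h′
  next-cong n {h} {h′} h≡h′ = cong (F n ÷_) (properPart-cong _ _ n agree)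
    where
    agree : ∀ d → 1 ≤ d → d < n → fromEarlier h d ≡ fromEarlier h′ d
    agree d _ _ with d <? n
    ... | yes d<n = h≡h′ d<n
    ... | no _ = refl

  c : Seq
  c = <-rec (λ _ → ℕ) next

  c-unfold : ∀ n → c n ≡ F n ÷ properPart c n
  c-unfold n = begin
    c n                    ≡⟨ FixPoint.unfold-wfRec <-wellFounded (λ _ → ℕ) next next-cong ⟩
    next n (λ {d} _ → c d) ≡⟨ cong (F n ÷_) (properPart-cong _ _ n earlier) ⟩
    F n ÷ properPart c n   ∎
    where
    earlier : ∀ d → 1 ≤ d → d < n → fromEarlier {n} (λ {d} _ → c d) d ≡ c d
    earlier d _ d<n with d <? n
    ... | yes _ = refl
    ... | no d≮n = contradiction d<n d≮n

  encodes : ∀ N → EncodesUpTo c F N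
  encodes zero n 1≤n n≤0 = contradiction (≤-trans 1≤n n≤0) λ ()
  encodes (suc m) n 1≤n n≤N with m≤n⇒m<n∨m≡n n≤N
  ... | inj₁ (s≤s n≤m) = encodes m n 1≤n n≤m
  ... | inj₂ refl = begin
    encode′ c N     ≡⟨ encode′-split c N z<s ⟩
    c N * P         ≡⟨ cong (_* P) (c-unfold N) ⟩
    (F N ÷ P) * P   ≡⟨ *-comm (F N ÷ P) P ⟩
    P * (F N ÷ P)   ≡⟨ ÷-exact P-pos (properPart-∣ F-pos F-morphic m (encodes m)) ⟩
    F N             ∎
    where
    N = suc m
    P = properPart c N
    P-pos : 1 ≤ P
    P-pos = properPart-pos c N λ d p d<N → proj₁ (agreement⇒pos F-pos (encodes m) p (≤-pred d<N))

  admissible : Admissible c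
  admissible = c-pos , coprime⇒C1 {c = c} λ k n 1≤k k<n k∤n →
    agreement⇒coprime {c = c} F-pos F-morphic (encodes n) 1≤k k<n k∤n
    where
    c-pos : Positive c
    c-pos n p = proj₁ (agreement⇒pos F-pos (encodes n) p ≤-refl)

surjective : ∀ F → Positive F → GCDMorphic F → Σ[ c ∈ Seq ] (Admissible c × encode c ≋ F)
surjective F F-pos F-morphic =
  c , admissible , λ n p → trans (encode≡encode′ c n) (encodes n n p ≤-refl)
  where open Surjectivity F F-pos F-morphic

mainTheorem4 : (∀ (c : Seq) → Admissible c → Positive (encode c) × GCDMorphic (encode c))
    × (∀ (c c′ : Seq) → Admissible c → Admissible c′ → encode c ≋ encode c′ → c ≋ c′)
    × (∀ (F : Seq) → Positive F → GCDMorphic F → Σ[ c ∈ Seq ] (Admissible c × encode c ≋ F))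
mainTheorem4 = well-defined , injective , surjective
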